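{- Let $n$ be a positive multiple of four. Let $N$ be the matrix whose rows are indexed by the unordered pairs $\{A,[n]\setminus A\}$ with $A\subseteq[n]$, $|A|=n/2$, and whose columns are indexed by the $2$-subsets $p$ of $[n]$, with entry $(-1)^{|A\cap p|}$ in row $\{A,[n]\setminus A\}$ and column $p$. Let $\widetilde N=\begin{pmatrix}N&\mathbf 1\end{pmatrix}$. Let $B$ be the $n\times\binom n2$ vertex–edge incidence matrix of the complete graph $K_n$ (rows indexed by $[n]$, columns by $2$-subsets), and $\widetilde B=\begin{pmatrix}B&\mathbf 1\end{pmatrix}$. Then the kernel of $\widetilde N$ (as a subspace of $\mathbb R^{\binom n2+1}$) equals the row space of $\widetilde B$.
   Context: $\mathbf 1$ denotes an all-ones column vector of the appropriate length. The rows of $N$ correspond to the neighbourhood, in the graph $Y_n$ (vertices: pairs $\{A,[n]\setminus A\}$ with $|A|$ even, adjacency: $|A\triangle B|=n/2$), of the vertex $\{\emptyset,[n]\}$.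
   Formalization: The kernel of $\widetilde N$ and the row space of $\widetilde B$ are taken over ℚ rather than ℝ, so vectors have rational coordinates and row combinations have rational coefficients. -}

module Defs where

open import Data.Nat using (ℕ; zero; suc; _+_; _<_)
open import Data.Fin using (Fin) renaming (_<_ to _<ᶠ_; _<?_ to _<ᶠ?_)
open import Data.Fin.Subset using (Subset)
open import Data.Vec using (lookup)
open import Data.Bool using (Bool; true; false)
open import Data.List using (List; []; _∷_; concatMap; mapMaybe; foldr)
open import Data.List using (allFin)
open import Data.Maybe using (Maybe; just; nothing)
open import Data.Rational using (ℚ; 0ℚ; 1ℚ; -_) renaming (_+_ to _+ℚ_; _*_ to _*ℚ_)
open import Relation.Nullary using (yes; no)

-- A 2-subset {i , j} of [n] = Fin n, represented canonically with i < j.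
record Pair (n : ℕ) : Set where
  constructor pair
  field
    fst : Fin n
    snd : Fin n
    fst<snd : fst <ᶠ snd
open Pair public

allPairs : (n : ℕ) → List (Pair n)
allPairs n = concatMap (λ i → mapMaybe (mk i) (allFin n)) (allFin n)
  where
  mk : Fin n → Fin n → Maybe (Pair n)
  mk i j with i <ᶠ? j
  ... | yes p = just (pair i j p)
  ... | no _  = nothing

sumℚ : List ℚ → ℚ
sumℚ = foldr _+ℚ_ 0ℚ

sumPairs : (n : ℕ) → (Pair n → ℚ) → ℚ
sumPairs n f = sumℚ (Data.List.map f (allPairs n))

sumFin : (n : ℕ) → (Fin n → ℚ) → ℚ
sumFin n f = sumℚ (Data.List.map f (allFin n))

negOnePow : ℕ → ℚ
negOnePow zero = 1ℚ
negOnePow (suc k) = - negOnePow k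

bit : Bool → ℕ
bit true = 1
bit false = 0

interCard : {n : ℕ} → Subset n → Pair n → ℕ
interCard A p = bit (lookup A (fst p)) + bit (lookup A (snd p))

-- Entry of N in the row {A, [n] \ A} and column p : (-1)^{|A ∩ p|}.
-- (This is independent of the chosen representative A since |p| = 2.)
Nentry : {n : ℕ} → Subset n → Pair n → ℚ
Nentry A p = negOnePow (interCard A p)

-- Vectors in ℚ^{binom n 2 + 1}: a function on 2-subsets together with the last coordinate.
-- x ∈ ker Ñ  iff  for every row {A,[n]\A} (|A| = n/2):  Σ_p N_{A,p} x_p + c = 0.
InKernelÑ : (n : ℕ) → (Subset n → Set) → (Pair n → ℚ) → ℚ → Set
InKernelÑ n IsRowRep x c =
  (A : Subset n) → IsRowRep A → sumPairs n (λ p → Nentry A p *ℚ x p) +ℚ c ≡ 0ℚ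
  where open import Relation.Binary.PropositionalEquality using (_≡_)

Bentry : {n : ℕ} → Fin n → Pair n → ℚ
Bentry v p with v Data.Fin.≟ fst p | v Data.Fin.≟ snd p
... | yes _ | _     = 1ℚ
... | no _  | yes _ = 1ℚ
... | no _  | no _  = 0ℚ

InRowSpaceB̃ : (n : ℕ) → (Pair n → ℚ) → ℚ → Set
InRowSpaceB̃ n x c =
  Σ (Fin n → ℚ) λ λ' →
    ((p : Pair n) → x p ≡ sumFin n (λ v → λ' v *ℚ Bentry v p))
    × (c ≡ sumFin n (λ v → λ' v *ℚ 1ℚ))
  where
  open import Data.Product using (Σ; _×_)
  open import Relation.Binary.PropositionalEquality using (_≡_)

{-# OPTIONS --safe #-}
-- For A ⊆ [n] let s_A be its ±1 vector (−1 on A). Since (−1)^|A ∩ {a,b}| = s_A(a) s_A(b), the row of Ñ at A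
-- sends (x, c) to Q_x(s_A) + c, where Q_x(s) = Σ_{a<b} s_a s_b x_ab.
--
-- Row space ⊆ kernel: if x_ab = μ_a + μ_b and c = Σ μ, then Q_x(s) = Σ_a s_a μ_a (Σ_b s_b − s_a) = −Σ μ
-- whenever Σ s = 0 and every s_a² = 1, which is the case for s_A with |A| = n/2.
--
-- Kernel ⊆ row space: Q_x is constant on balanced sign vectors. For distinct i, j, k, l pick a balanced A
-- separating i from j and k from l; exchanging i with j and k with l yields four balanced sets, and the
-- second difference of Q_x along the two exchanges is (s_j − s_i)(s_l − s_k)(x_ik − x_il − x_jk + x_jl).
-- Hence every alternating 4-cycle sum of x vanishes, which forces x_ab = μ_a + μ_b with
-- 2 μ_a = x_ab + x_at − x_bt for any b, t; a single row of Ñ then gives c = Σ μ.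
module Submission where

open import Defs
open import Data.Nat using (ℕ; _<_; _/_)
open import Data.Nat.Divisibility using (_∣_; divides)
open import Data.Nat.DivMod using (m*n/n≡m)
open import Data.Fin.Subset using (Subset; ∣_∣)
open import Data.Rational using (ℚ)
open import Data.Product using (_×_)
open import Relation.Binary.PropositionalEquality using (_≡_)

import Data.Rational.Properties as ℚₚ
open import Algebra.Bundles using (CommutativeRing)
open import Algebra.Properties.Group ℚₚ.+-0-group using (∙-cancelˡ; ∙-cancelʳ; identityʳ-unique)
import Algebra.Properties.CommutativeMonoid.Sum as CommutativeMonoidSum
open import Algebra.Definitions.RawMonoid Data.Rational.+-0-rawMonoid using () renaming (_×_ to _×ℚ_)
open import Data.Bool using (Bool; true; false; not)
import Data.Bool.Properties as Boolₚ
open import Data.Empty using (⊥-elim)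
open import Data.Fin using (Fin; zero; suc) renaming (_<?_ to _<ᶠ?_)
import Data.Fin.Properties as Finₚ
import Data.Fin.Permutation as Perm
import Data.Fin.Permutation.Components as PC
open import Data.Fin.Subset using (∁)
open import Data.Fin.Subset.Properties using (∣∁p∣≡n∸∣p∣)
open import Data.List using (List; []; _∷_; _++_; map; concatMap; mapMaybe; allFin)
import Data.List as List
import Data.List.Properties as Listₚ
open import Data.Maybe using (Maybe; just; nothing; maybe)
import Data.Nat as ℕ
open import Data.Nat using (zero; suc)
import Data.Nat.Properties as ℕₚ
open import Data.Product using (Σ-syntax; ∃-syntax; _,_; proj₁; proj₂)
import Data.Product as Product
open import Data.Vec using ([]; _∷_; lookup)
import Data.Vec as Vec
import Data.Vec.Properties as Vecₚ
open import Data.Rational using (0ℚ; 1ℚ; ½; _+_; _*_; -_; _-_)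
open import Data.Rational.Solver using (module +-*-Solver)
open import Function using (_∘_; id)
open import Relation.Nullary using (yes; no)
open import Relation.Nullary.Decidable using (dec-true; dec-false)
open import Relation.Binary using (tri<; tri≈; tri>)
open import Relation.Binary.PropositionalEquality
  using (_≢_; refl; sym; trans; cong; cong₂; subst; module ≡-Reasoning)

open import Algebra.Properties.Semiring.Sum (CommutativeRing.semiring ℚₚ.+-*-commutativeRing)
  using (sum-syntax; sum-cong-≗; sum-replicate-zero; ∑-distrib-+; ∑-comm; *-distribˡ-sum)
open +-*-Solver
open ≡-Reasoning

module ℕSum = CommutativeMonoidSum ℕₚ.+-0-commutativeMonoid

private
  variable
    n : ℕ

sumℚ-tabulate : (f : Fin n → ℚ) → sumℚ (List.tabulate f) ≡ ∑[ i < n ] f i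
sumℚ-tabulate {zero}  f = refl
sumℚ-tabulate {suc n} f = cong (f zero +_) (sumℚ-tabulate (f ∘ suc))

sumFin≡∑ : (f : Fin n → ℚ) → sumFin n f ≡ ∑[ i < n ] f i
sumFin≡∑ f = trans (cong sumℚ (Listₚ.map-tabulate id f)) (sumℚ-tabulate f)

sumℚ-++ : (xs ys : List ℚ) → sumℚ (xs ++ ys) ≡ sumℚ xs + sumℚ ys
sumℚ-++ []       ys = sym (ℚₚ.+-identityˡ _)
sumℚ-++ (x ∷ xs) ys = trans (cong (x +_) (sumℚ-++ xs ys)) (sym (ℚₚ.+-assoc x _ _))

sumℚ-concatMap : {A B : Set} (g : A → List B) (f : B → ℚ) (xs : List A) →
  sumℚ (map f (concatMap g xs)) ≡ sumℚ (map (λ a → sumℚ (map f (g a))) xs)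
sumℚ-concatMap g f []       = refl
sumℚ-concatMap g f (x ∷ xs) = begin
  sumℚ (map f (g x ++ concatMap g xs))                ≡⟨ cong sumℚ (Listₚ.map-++ f (g x) _) ⟩
  sumℚ (map f (g x) ++ map f (concatMap g xs))        ≡⟨ sumℚ-++ (map f (g x)) _ ⟩
  sumℚ (map f (g x)) + sumℚ (map f (concatMap g xs))  ≡⟨ cong (sumℚ (map f (g x)) +_) (sumℚ-concatMap g f xs) ⟩
  sumℚ (map (λ a → sumℚ (map f (g a))) (x ∷ xs))      ∎

sumℚ-mapMaybe : {A B : Set} (g : A → Maybe B) (f : B → ℚ) (xs : List A) →
  sumℚ (map f (mapMaybe g xs)) ≡ sumℚ (map (maybe f 0ℚ ∘ g) xs)
sumℚ-mapMaybe g f []       = refl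
sumℚ-mapMaybe g f (x ∷ xs) with g x
... | just b  = cong (f b +_) (sumℚ-mapMaybe g f xs)
... | nothing = trans (sumℚ-mapMaybe g f xs) (sym (ℚₚ.+-identityˡ _))

sumℚ-map-+ : {A : Set} (f g : A → ℚ) (xs : List A) →
  sumℚ (map (λ a → f a + g a) xs) ≡ sumℚ (map f xs) + sumℚ (map g xs)
sumℚ-map-+ f g []       = refl
sumℚ-map-+ f g (x ∷ xs) = trans (cong (f x + g x +_) (sumℚ-map-+ f g xs))
  (solve 4 (λ a b c d → (a :+ b) :+ (c :+ d) := (a :+ c) :+ (b :+ d))
     refl (f x) (g x) (sumℚ (map f xs)) (sumℚ (map g xs)))

∑∑-distrib-+ : (f g : Fin n → Fin n → ℚ) →
  ∑[ a < n ] ∑[ b < n ] (f a b + g a b) ≡ ∑[ a < n ] ∑[ b < n ] f a b + ∑[ a < n ] ∑[ b < n ] g a b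
∑∑-distrib-+ {n} f g = trans (sum-cong-≗ (λ a → ∑-distrib-+ (f a) (g a)))
  (∑-distrib-+ (λ a → ∑[ b < n ] f a b) (λ a → ∑[ b < n ] g a b))

δ : Fin n → Fin n → ℚ
δ zero    zero    = 1ℚ
δ zero    (suc _) = 0ℚ
δ (suc _) zero    = 0ℚ
δ (suc i) (suc j) = δ i j

δ-refl : (i : Fin n) → δ i i ≡ 1ℚ
δ-refl zero    = refl
δ-refl (suc i) = δ-refl i

δ-≢ : {i j : Fin n} → i ≢ j → δ i j ≡ 0ℚ
δ-≢ {i = zero}  {zero}  i≢j = ⊥-elim (i≢j refl)
δ-≢ {i = zero}  {suc j} _   = refl
δ-≢ {i = suc i} {zero}  _   = refl
δ-≢ {i = suc i} {suc j} i≢j = δ-≢ (i≢j ∘ cong suc)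

∑-δ : (i : Fin n) (f : Fin n → ℚ) → ∑[ j < n ] (δ i j * f j) ≡ f i
∑-δ {suc n} zero f = begin
  1ℚ * f zero + ∑[ j < n ] (0ℚ * f (suc j))
    ≡⟨ cong₂ _+_ (ℚₚ.*-identityˡ (f zero))
                 (trans (sum-cong-≗ (ℚₚ.*-zeroˡ ∘ f ∘ suc)) (sum-replicate-zero n)) ⟩
  f zero + 0ℚ
    ≡⟨ ℚₚ.+-identityʳ _ ⟩
  f zero ∎
∑-δ {suc n} (suc i) f = trans (cong₂ _+_ (ℚₚ.*-zeroˡ (f zero)) (∑-δ i (f ∘ suc))) (ℚₚ.+-identityˡ _)

∑-δ-difference : (i j : Fin n) (f : Fin n → ℚ) → ∑[ a < n ] ((δ i a - δ j a) * f a) ≡ f i - f j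
∑-δ-difference {n} i j f = begin
  ∑[ a < n ] ((δ i a - δ j a) * f a)
    ≡⟨ solve 2 (λ s t → s := s :+ t :- t) refl (∑[ a < n ] ((δ i a - δ j a) * f a)) (f j) ⟩
  ∑[ a < n ] ((δ i a - δ j a) * f a) + f j - f j
    ≡⟨ cong (λ t → ∑[ a < n ] ((δ i a - δ j a) * f a) + t - f j) (sym (∑-δ j f)) ⟩
  ∑[ a < n ] ((δ i a - δ j a) * f a) + ∑[ a < n ] (δ j a * f a) - f j
    ≡⟨ cong (_- f j) (sym (∑-distrib-+ (λ a → (δ i a - δ j a) * f a) (λ a → δ j a * f a))) ⟩
  ∑[ a < n ] ((δ i a - δ j a) * f a + δ j a * f a) - f j
    ≡⟨ cong (_- f j) (sum-cong-≗ λ a →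
         solve 3 (λ x y z → (x :- y) :* z :+ y :* z := x :* z) refl (δ i a) (δ j a) (f a)) ⟩
  ∑[ a < n ] (δ i a * f a) - f j
    ≡⟨ cong (_- f j) (∑-δ i f) ⟩
  f i - f j ∎

∑∑-δ-differences : (c d : ℚ) (i j k l : Fin n) (M : Fin n → Fin n → ℚ) →
  ∑[ a < n ] ∑[ b < n ] (c * (δ i a - δ j a) * (d * (δ k b - δ l b)) * M a b)
    ≡ c * d * (M i k - M i l - (M j k - M j l))
∑∑-δ-differences {n} c d i j k l M = begin
  ∑[ a < n ] ∑[ b < n ] (c * (δ i a - δ j a) * (d * (δ k b - δ l b)) * M a b)
    ≡⟨ sum-cong-≗ (λ a → trans
         (sum-cong-≗ λ b → solve 5 (λ c d x y m → c :* x :* (d :* y) :* m := x :* (c :* d) :* (y :* m))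
                             refl c d (δ i a - δ j a) (δ k b - δ l b) (M a b))
         (sym (*-distribˡ-sum ((δ i a - δ j a) * (c * d)) (λ b → (δ k b - δ l b) * M a b)))) ⟩
  ∑[ a < n ] ((δ i a - δ j a) * (c * d) * ∑[ b < n ] ((δ k b - δ l b) * M a b))
    ≡⟨ sum-cong-≗ (λ a → trans (cong ((δ i a - δ j a) * (c * d) *_) (∑-δ-difference k l (M a)))
                              (ℚₚ.*-assoc (δ i a - δ j a) (c * d) (M a k - M a l))) ⟩
  ∑[ a < n ] ((δ i a - δ j a) * (c * d * (M a k - M a l)))
    ≡⟨ ∑-δ-difference i j (λ a → c * d * (M a k - M a l)) ⟩
  c * d * (M i k - M i l) - c * d * (M j k - M j l)
    ≡⟨ solve 5 (λ e p q r t → e :* (p :- q) :- e :* (r :- t) := e :* (p :- q :- (r :- t)))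
         refl (c * d) (M i k) (M i l) (M j k) (M j l) ⟩
  c * d * (M i k - M i l - (M j k - M j l)) ∎

-- The selector used by Defs.allPairs is local to its where-block; unification recovers it.
pairSelector : (n : ℕ) → Σ[ select ∈ (Fin n → Fin n → Maybe (Pair n)) ]
  allPairs n ≡ concatMap (λ a → mapMaybe (select a) (allFin n)) (allFin n)
pairSelector n = _ , refl

upper : (Pair n → ℚ) → Fin n → Fin n → ℚ
upper f a b with a <ᶠ? b
... | yes a<b = f (pair a b a<b)
... | no  _   = 0ℚ

select≡upper : (f : Pair n → ℚ) (a b : Fin n) → maybe f 0ℚ (proj₁ (pairSelector n) a b) ≡ upper f a b
select≡upper f a b with a <ᶠ? b
... | yes _ = refl
... | no  _ = refl

sumPairs≡∑∑upper : (f : Pair n → ℚ) → sumPairs n f ≡ ∑[ a < n ] ∑[ b < n ] upper f a b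
sumPairs≡∑∑upper {n} f = begin
  sumPairs n f
    ≡⟨ cong (sumℚ ∘ map f) (proj₂ (pairSelector n)) ⟩
  sumℚ (map f (concatMap row (allFin n)))
    ≡⟨ sumℚ-concatMap row f (allFin n) ⟩
  sumFin n (λ a → sumℚ (map f (row a)))
    ≡⟨ sumFin≡∑ (λ a → sumℚ (map f (row a))) ⟩
  ∑[ a < n ] sumℚ (map f (row a))
    ≡⟨ sum-cong-≗ (λ a → trans (sumℚ-mapMaybe (select a) f (allFin n))
                         (trans (sumFin≡∑ (maybe f 0ℚ ∘ select a)) (sum-cong-≗ (select≡upper f a)))) ⟩
  ∑[ a < n ] ∑[ b < n ] upper f a b ∎
  where
  select : Fin n → Fin n → Maybe (Pair n)
  select = proj₁ (pairSelector n)
  row : Fin n → List (Pair n)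
  row a = mapMaybe (select a) (allFin n)

sumPairs-cong : {f g : Pair n → ℚ} → (∀ p → f p ≡ g p) → sumPairs n f ≡ sumPairs n g
sumPairs-cong {n} f≗g = cong sumℚ (Listₚ.map-cong f≗g (allPairs n))

sumPairs-+ : (f g : Pair n → ℚ) → sumPairs n (λ p → f p + g p) ≡ sumPairs n f + sumPairs n g
sumPairs-+ {n} f g = sumℚ-map-+ f g (allPairs n)

[_<_] : Fin n → Fin n → ℚ
[ a < b ] = upper (λ _ → 1ℚ) a b

upper-pointwise : (g : Fin n → Fin n → ℚ) (a b : Fin n) →
  upper (λ p → g (fst p) (snd p)) a b ≡ [ a < b ] * g a b
upper-pointwise g a b with a <ᶠ? b
... | yes _ = sym (ℚₚ.*-identityˡ (g a b))
... | no  _ = sym (ℚₚ.*-zeroˡ (g a b))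

trichotomy : (a b : Fin n) → [ a < b ] + [ b < a ] + δ a b ≡ 1ℚ
trichotomy a b with a <ᶠ? b | b <ᶠ? a
... | yes a<b | yes b<a = ⊥-elim (Finₚ.<-asym a<b b<a)
... | yes a<b | no  _   = cong (1ℚ + 0ℚ +_) (δ-≢ (Finₚ.<⇒≢ a<b))
... | no  _   | yes b<a = cong (0ℚ + 1ℚ +_) (δ-≢ (Finₚ.<⇒≢ b<a ∘ sym))
... | no  a≮b | no  b≮a with Finₚ.<-cmp a b
...   | tri< a<b _    _   = ⊥-elim (a≮b a<b)
...   | tri> _   _    b<a = ⊥-elim (b≮a b<a)
...   | tri≈ _   refl _   = cong (0ℚ + 0ℚ +_) (δ-refl a)

sumPairs-symmetrize : (g : Fin n → Fin n → ℚ) →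
  sumPairs n (λ p → g (fst p) (snd p) + g (snd p) (fst p)) + ∑[ a < n ] g a a
    ≡ ∑[ a < n ] ∑[ b < n ] g a b
sumPairs-symmetrize {n} g = begin
  sumPairs n (λ p → g (fst p) (snd p) + g (snd p) (fst p)) + ∑[ a < n ] g a a
    ≡⟨ cong₂ _+_ (trans (sumPairs≡∑∑upper (λ p → g (fst p) (snd p) + g (snd p) (fst p)))
                         (sum-cong-≗ λ a → sum-cong-≗ λ b →
                    trans (upper-pointwise (λ a b → g a b + g b a) a b) (ℚₚ.*-distribˡ-+ [ a < b ] (g a b) (g b a))))
                 (sum-cong-≗ λ a → sym (∑-δ a (g a))) ⟩
  ∑∑ (λ a b → aboveDiag a b + aboveDiagᵀ a b) + ∑∑ diagonal
    ≡⟨ cong (_+ ∑∑ diagonal)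
         (trans (∑∑-distrib-+ aboveDiag aboveDiagᵀ) (cong (∑∑ aboveDiag +_) (∑-comm aboveDiagᵀ))) ⟩
  ∑∑ aboveDiag + ∑∑ belowDiag + ∑∑ diagonal
    ≡⟨ sym (trans (∑∑-distrib-+ (λ a b → aboveDiag a b + belowDiag a b) diagonal)
                  (cong (_+ ∑∑ diagonal) (∑∑-distrib-+ aboveDiag belowDiag))) ⟩
  ∑∑ (λ a b → aboveDiag a b + belowDiag a b + diagonal a b)
    ≡⟨ (sum-cong-≗ λ a → sum-cong-≗ λ b → begin
         aboveDiag a b + belowDiag a b + diagonal a b
           ≡⟨ solve 4 (λ x y z w → x :* w :+ y :* w :+ z :* w := (x :+ y :+ z) :* w) refl
                [ a < b ] [ b < a ] (δ a b) (g a b) ⟩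
         ([ a < b ] + [ b < a ] + δ a b) * g a b
           ≡⟨ cong (_* g a b) (trichotomy a b) ⟩
         1ℚ * g a b
           ≡⟨ ℚₚ.*-identityˡ (g a b) ⟩
         g a b ∎) ⟩
  ∑∑ g ∎
  where
  ∑∑ : (Fin n → Fin n → ℚ) → ℚ
  ∑∑ f = ∑[ a < n ] ∑[ b < n ] f a b
  aboveDiag aboveDiagᵀ belowDiag diagonal : Fin n → Fin n → ℚ
  aboveDiag  a b = [ a < b ] * g a b
  aboveDiagᵀ a b = [ a < b ] * g b a
  belowDiag  a b = [ b < a ] * g a b
  diagonal   a b = δ a b * g a b

-- The quadratic form Q_x

pairForm : (Fin n → ℚ) → (Pair n → ℚ) → ℚ
pairForm {n} s x = sumPairs n (λ p → s (fst p) * s (snd p) * x p)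

pairForm-cong : {s s′ : Fin n → ℚ} {x x′ : Pair n → ℚ} →
  (∀ v → s v ≡ s′ v) → (∀ p → x p ≡ x′ p) → pairForm s x ≡ pairForm s′ x′
pairForm-cong s≗s′ x≗x′ = sumPairs-cong λ p →
  cong₂ _*_ (cong₂ _*_ (s≗s′ (fst p)) (s≗s′ (snd p))) (x≗x′ p)

pairForm-edgeSums : (s μ : Fin n → ℚ) → ∑[ v < n ] s v ≡ 0ℚ → (∀ v → s v * s v ≡ 1ℚ) →
  pairForm s (λ p → μ (fst p) + μ (snd p)) + ∑[ v < n ] μ v ≡ 0ℚ
pairForm-edgeSums {n} s μ ∑s≡0 s²≡1 = begin
  pairForm s (λ p → μ (fst p) + μ (snd p)) + ∑[ v < n ] μ v
    ≡⟨ cong₂ _+_ (sumPairs-cong λ p → solve 4 (λ sa sb ma mb → sa :* sb :* (ma :+ mb) :=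
                    sa :* ma :* sb :+ sb :* mb :* sa) refl (s (fst p)) (s (snd p)) (μ (fst p)) (μ (snd p)))
                 (sum-cong-≗ λ v → sym (begin
                    s v * μ v * s v   ≡⟨ solve 2 (λ x m → x :* m :* x := (x :* x) :* m) refl (s v) (μ v) ⟩
                    s v * s v * μ v   ≡⟨ cong (_* μ v) (s²≡1 v) ⟩
                    1ℚ * μ v          ≡⟨ ℚₚ.*-identityˡ (μ v) ⟩
                    μ v               ∎)) ⟩
  sumPairs n (λ p → g (fst p) (snd p) + g (snd p) (fst p)) + ∑[ v < n ] g v v
    ≡⟨ sumPairs-symmetrize g ⟩
  ∑[ a < n ] ∑[ b < n ] (s a * μ a * s b)
    ≡⟨ sum-cong-≗ (λ a → sym (*-distribˡ-sum (s a * μ a) s)) ⟩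
  ∑[ a < n ] (s a * μ a * ∑[ b < n ] s b)
    ≡⟨ sum-cong-≗ (λ a → trans (cong (s a * μ a *_) ∑s≡0) (ℚₚ.*-zeroʳ (s a * μ a))) ⟩
  ∑[ a < n ] 0ℚ
    ≡⟨ sum-replicate-zero n ⟩
  0ℚ ∎
  where
  g : Fin n → Fin n → ℚ
  g a b = s a * μ a * s b

symExt : (Pair n → ℚ) → Fin n → Fin n → ℚ
symExt x a b = upper x a b + upper x b a

symExt-comm : (x : Pair n → ℚ) (a b : Fin n) → symExt x a b ≡ symExt x b a
symExt-comm x a b = ℚₚ.+-comm (upper x a b) (upper x b a)

symExt-diag : (x : Pair n → ℚ) (a : Fin n) → symExt x a a ≡ 0ℚ
symExt-diag x a with a <ᶠ? a
... | yes a<a = ⊥-elim (Finₚ.<-irrefl refl a<a)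
... | no  _   = refl

symExt-pair : (x : Pair n → ℚ) (p : Pair n) → x p ≡ symExt x (fst p) (snd p)
symExt-pair x (pair a b a<b) with a <ᶠ? b | b <ᶠ? a
... | yes a<b′ | no  _   = trans (cong (x ∘ pair a b) (Finₚ.<-irrelevant a<b a<b′)) (sym (ℚₚ.+-identityʳ _))
... | yes _    | yes b<a = ⊥-elim (Finₚ.<-asym a<b b<a)
... | no  a≮b  | _       = ⊥-elim (a≮b a<b)

sumPairs-bilinear : (x : Pair n → ℚ) (u v : Fin n → ℚ) →
  sumPairs n (λ p → (u (fst p) * v (snd p) + u (snd p) * v (fst p)) * x p)
    ≡ ∑[ a < n ] ∑[ b < n ] (u a * v b * symExt x a b)
sumPairs-bilinear {n} x u v = begin
  sumPairs n (λ p → (u (fst p) * v (snd p) + u (snd p) * v (fst p)) * x p)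
    ≡⟨ sumPairs-cong (λ p → let a = fst p; b = snd p in begin
         (u a * v b + u b * v a) * x p
           ≡⟨ cong ((u a * v b + u b * v a) *_) (symExt-pair x p) ⟩
         (u a * v b + u b * v a) * X a b
           ≡⟨ ℚₚ.*-distribʳ-+ (X a b) (u a * v b) (u b * v a) ⟩
         u a * v b * X a b + u b * v a * X a b
           ≡⟨ cong (λ y → g a b + u b * v a * y) (symExt-comm x a b) ⟩
         g a b + g b a ∎) ⟩
  sumPairs n (λ p → g (fst p) (snd p) + g (snd p) (fst p))
    ≡⟨ sym (ℚₚ.+-identityʳ _) ⟩
  sumPairs n (λ p → g (fst p) (snd p) + g (snd p) (fst p)) + 0ℚ
    ≡⟨ cong (sumPairs n (λ p → g (fst p) (snd p) + g (snd p) (fst p)) +_) (sym diagonal≡0) ⟩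
  sumPairs n (λ p → g (fst p) (snd p) + g (snd p) (fst p)) + ∑[ a < n ] g a a
    ≡⟨ sumPairs-symmetrize g ⟩
  ∑[ a < n ] ∑[ b < n ] g a b ∎
  where
  X : Fin n → Fin n → ℚ
  X = symExt x
  g : Fin n → Fin n → ℚ
  g a b = u a * v b * X a b
  diagonal≡0 : ∑[ a < n ] g a a ≡ 0ℚ
  diagonal≡0 = trans (sum-cong-≗ λ a → trans (cong (u a * v a *_) (symExt-diag x a))
                                             (ℚₚ.*-zeroʳ (u a * v a)))
                     (sum-replicate-zero n)

pairForm-polarization : (x : Pair n → ℚ) (s u v : Fin n → ℚ) →
  pairForm (λ w → s w + u w + v w) x + pairForm s x
    ≡ pairForm (λ w → s w + u w) x + pairForm (λ w → s w + v w) x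
      + ∑[ a < n ] ∑[ b < n ] (u a * v b * symExt x a b)
pairForm-polarization {n} x s u v = begin
  pairForm (λ w → s w + u w + v w) x + pairForm s x
    ≡⟨ sym (sumPairs-+ (form (λ w → s w + u w + v w)) (form s)) ⟩
  sumPairs n (λ p → form (λ w → s w + u w + v w) p + form s p)
    ≡⟨ sumPairs-cong (λ p → solve 7 (λ sa sb ua ub va vb y →
         (sa :+ ua :+ va) :* (sb :+ ub :+ vb) :* y :+ sa :* sb :* y :=
         (sa :+ ua) :* (sb :+ ub) :* y :+ (sa :+ va) :* (sb :+ vb) :* y :+ (ua :* vb :+ ub :* va) :* y)
         refl (s (fst p)) (s (snd p)) (u (fst p)) (u (snd p)) (v (fst p)) (v (snd p)) (x p)) ⟩
  sumPairs n (λ p → form (λ w → s w + u w) p + form (λ w → s w + v w) p + cross p)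
    ≡⟨ trans (sumPairs-+ (λ p → form (λ w → s w + u w) p + form (λ w → s w + v w) p) cross)
             (cong (_+ sumPairs n cross) (sumPairs-+ (form (λ w → s w + u w)) (form (λ w → s w + v w)))) ⟩
  pairForm (λ w → s w + u w) x + pairForm (λ w → s w + v w) x + sumPairs n cross
    ≡⟨ cong (pairForm (λ w → s w + u w) x + pairForm (λ w → s w + v w) x +_) (sumPairs-bilinear x u v) ⟩
  pairForm (λ w → s w + u w) x + pairForm (λ w → s w + v w) x
    + ∑[ a < n ] ∑[ b < n ] (u a * v b * symExt x a b) ∎
  where
  form : (Fin n → ℚ) → Pair n → ℚ
  form t p = t (fst p) * t (snd p) * x p
  cross : Pair n → ℚ
  cross p = (u (fst p) * v (snd p) + u (snd p) * v (fst p)) * x p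

transpose-matchˡ : (i j : Fin n) → PC.transpose i j i ≡ j
transpose-matchˡ i j rewrite dec-true (i Finₚ.≟ i) refl = refl

transpose-other : {i j w : Fin n} → w ≢ i → w ≢ j → PC.transpose i j w ≡ w
transpose-other {i = i} {j} {w} w≢i w≢j
  rewrite dec-false (w Finₚ.≟ i) w≢i | dec-false (w Finₚ.≟ j) w≢j = refl

∘transpose : (f : Fin n → ℚ) {i j : Fin n} → i ≢ j → (w : Fin n) →
  f (PC.transpose i j w) ≡ f w + (f j - f i) * (δ i w - δ j w)
∘transpose f {i} {j} i≢j w with w Finₚ.≟ i
... | yes refl = begin
  f j
    ≡⟨ solve 2 (λ a b → b := a :+ (b :- a) :* (con 1ℚ :- con 0ℚ)) refl (f i) (f j) ⟩
  f i + (f j - f i) * (1ℚ - 0ℚ)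
    ≡⟨ cong₂ (λ d e → f i + (f j - f i) * (d - e)) (sym (δ-refl i)) (sym (δ-≢ (i≢j ∘ sym))) ⟩
  f i + (f j - f i) * (δ i i - δ j i) ∎
... | no w≢i with w Finₚ.≟ j
...   | yes refl = begin
  f i
    ≡⟨ solve 2 (λ a b → b := a :+ (a :- b) :* (con 0ℚ :- con 1ℚ)) refl (f j) (f i) ⟩
  f j + (f j - f i) * (0ℚ - 1ℚ)
    ≡⟨ cong₂ (λ d e → f j + (f j - f i) * (d - e)) (sym (δ-≢ i≢j)) (sym (δ-refl j)) ⟩
  f j + (f j - f i) * (δ i j - δ j j) ∎
...   | no w≢j = begin
  f w
    ≡⟨ solve 2 (λ a c → a := a :+ c :* (con 0ℚ :- con 0ℚ)) refl (f w) (f j - f i) ⟩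
  f w + (f j - f i) * (0ℚ - 0ℚ)
    ≡⟨ cong₂ (λ d e → f w + (f j - f i) * (d - e)) (sym (δ-≢ (w≢i ∘ sym))) (sym (δ-≢ (w≢j ∘ sym))) ⟩
  f w + (f j - f i) * (δ i w - δ j w) ∎

pairForm-doubleTransposition : (x : Pair n → ℚ) (s : Fin n → ℚ) {i j k l : Fin n} →
  i ≢ j → i ≢ k → i ≢ l → j ≢ k → j ≢ l → k ≢ l →
  pairForm (s ∘ PC.transpose i j ∘ PC.transpose k l) x + pairForm s x
    ≡ pairForm (s ∘ PC.transpose i j) x + pairForm (s ∘ PC.transpose k l) x
      + (s j - s i) * (s l - s k) * (symExt x i k - symExt x i l - (symExt x j k - symExt x j l))
pairForm-doubleTransposition {n} x s {i} {j} {k} {l} i≢j i≢k i≢l j≢k j≢l k≢l = begin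
  pairForm (s ∘ PC.transpose i j ∘ PC.transpose k l) x + pairForm s x
    ≡⟨ cong (_+ pairForm s x) (pairForm-cong both (λ _ → refl)) ⟩
  pairForm (λ w → s w + u w + v w) x + pairForm s x
    ≡⟨ pairForm-polarization x s u v ⟩
  pairForm (λ w → s w + u w) x + pairForm (λ w → s w + v w) x
    + ∑[ a < n ] ∑[ b < n ] (u a * v b * symExt x a b)
    ≡⟨ cong₂ (λ y z → y + z + ∑[ a < n ] ∑[ b < n ] (u a * v b * symExt x a b))
         (pairForm-cong (sym ∘ ∘transpose s i≢j) (λ _ → refl))
         (pairForm-cong (sym ∘ ∘transpose s k≢l) (λ _ → refl)) ⟩
  pairForm (s ∘ PC.transpose i j) x + pairForm (s ∘ PC.transpose k l) x
    + ∑[ a < n ] ∑[ b < n ] (u a * v b * symExt x a b)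
    ≡⟨ cong (pairForm (s ∘ PC.transpose i j) x + pairForm (s ∘ PC.transpose k l) x +_)
         (∑∑-δ-differences (s j - s i) (s l - s k) i j k l (symExt x)) ⟩
  pairForm (s ∘ PC.transpose i j) x + pairForm (s ∘ PC.transpose k l) x
    + (s j - s i) * (s l - s k) * (symExt x i k - symExt x i l - (symExt x j k - symExt x j l)) ∎
  where
  u v : Fin n → ℚ
  u w = (s j - s i) * (δ i w - δ j w)
  v w = (s l - s k) * (δ k w - δ l w)
  -- transpose i j fixes k and l
  both : ∀ w → s (PC.transpose i j (PC.transpose k l w)) ≡ s w + u w + v w
  both w = trans (∘transpose (s ∘ PC.transpose i j) k≢l w)
    (cong₂ _+_ (∘transpose s i≢j w)
      (cong (_* (δ k w - δ l w))
        (cong₂ _-_ (cong s (transpose-other (i≢l ∘ sym) (j≢l ∘ sym)))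
                   (cong s (transpose-other (i≢k ∘ sym) (j≢k ∘ sym))))))

-- Vanishing 4-cycle sums

avoid : 3 ℕ.≤ n → (a b : Fin n) → ∃[ t ] t ≢ a × t ≢ b
avoid (ℕ.s≤s (ℕ.s≤s (ℕ.s≤s _))) zero          (suc zero)    = suc (suc zero) , (λ ()) , (λ ())
avoid (ℕ.s≤s (ℕ.s≤s (ℕ.s≤s _))) zero          zero          = suc zero , (λ ()) , (λ ())
avoid (ℕ.s≤s (ℕ.s≤s (ℕ.s≤s _))) zero          (suc (suc _)) = suc zero , (λ ()) , (λ ())
avoid (ℕ.s≤s (ℕ.s≤s (ℕ.s≤s _))) (suc zero)    zero          = suc (suc zero) , (λ ()) , (λ ())
avoid (ℕ.s≤s (ℕ.s≤s (ℕ.s≤s _))) (suc (suc _)) zero          = suc zero , (λ ()) , (λ ())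
avoid (ℕ.s≤s (ℕ.s≤s (ℕ.s≤s _))) (suc _)       (suc _)       = zero , (λ ()) , (λ ())

module Potential {n : ℕ} (3≤n : 3 ℕ.≤ n) (X : Fin n → Fin n → ℚ) (X-comm : ∀ a b → X a b ≡ X b a)
  (fourCycle : ∀ {i j k l} → i ≢ j → i ≢ k → i ≢ l → j ≢ k → j ≢ l → k ≢ l →
               X i k - X i l - (X j k - X j l) ≡ 0ℚ) where

  -- For distinct a, b, t this is twice the potential of a, whatever b and t are.
  L : Fin n → Fin n → Fin n → ℚ
  L a b t = X a b + X a t - X b t

  L-comm : (a b t : Fin n) → L a b t ≡ L a t b
  L-comm a b t = cong₂ _-_ (ℚₚ.+-comm (X a b) (X a t)) (X-comm b t)

  L-third : {a b t t′ : Fin n} → a ≢ b → a ≢ t → a ≢ t′ → b ≢ t → b ≢ t′ → L a b t ≡ L a b t′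
  L-third {a} {b} {t} {t′} a≢b a≢t a≢t′ b≢t b≢t′ with t Finₚ.≟ t′
  ... | yes refl = refl
  ... | no t≢t′ = begin
    L a b t
      ≡⟨ solve 5 (λ p q r s w → p :+ q :- r := (p :+ s :- w) :+ (q :- s :- (r :- w)))
           refl (X a b) (X a t) (X b t) (X a t′) (X b t′) ⟩
    L a b t′ + (X a t - X a t′ - (X b t - X b t′))
      ≡⟨ cong (L a b t′ +_) (fourCycle a≢b a≢t a≢t′ b≢t b≢t′ t≢t′) ⟩
    L a b t′ + 0ℚ
      ≡⟨ ℚₚ.+-identityʳ _ ⟩
    L a b t′ ∎

  L-indep : {a b t b′ t′ : Fin n} → a ≢ b → a ≢ t → b ≢ t → a ≢ b′ → a ≢ t′ → b′ ≢ t′ →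
    L a b t ≡ L a b′ t′
  L-indep {a} {b} {t} {b′} {t′} a≢b a≢t b≢t a≢b′ a≢t′ b′≢t′ with t′ Finₚ.≟ b
  ... | yes refl = trans (L-third a≢b a≢t a≢b′ b≢t (b′≢t′ ∘ sym)) (L-comm a t′ b′)
  ... | no t′≢b = begin
    L a b t    ≡⟨ L-third a≢b a≢t a≢t′ b≢t (t′≢b ∘ sym) ⟩
    L a b t′   ≡⟨ L-comm a b t′ ⟩
    L a t′ b   ≡⟨ L-third a≢t′ a≢b a≢b′ t′≢b (b′≢t′ ∘ sym) ⟩
    L a t′ b′  ≡⟨ L-comm a t′ b′ ⟩
    L a b′ t′  ∎

  leaf₁ leaf₂ : Fin n → Fin n
  leaf₁ a = proj₁ (avoid 3≤n a a)
  leaf₂ a = proj₁ (avoid 3≤n a (leaf₁ a))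

  potential : Fin n → ℚ
  potential a = ½ * L a (leaf₁ a) (leaf₂ a)

  potential-via : {a b t : Fin n} → a ≢ b → t ≢ a → t ≢ b → potential a ≡ ½ * L a b t
  potential-via {a} a≢b t≢a t≢b = cong (½ *_) (L-indep
    (proj₁ (proj₂ (avoid 3≤n a a)) ∘ sym) (proj₁ (proj₂ (avoid 3≤n a (leaf₁ a))) ∘ sym)
    (proj₂ (proj₂ (avoid 3≤n a (leaf₁ a))) ∘ sym) a≢b (t≢a ∘ sym) (t≢b ∘ sym))

  X≡potential+potential : {a b : Fin n} → a ≢ b → X a b ≡ potential a + potential b
  X≡potential+potential {a} {b} a≢b = sym (begin
    potential a + potential b
      ≡⟨ cong₂ _+_ (potential-via a≢b t≢a t≢b) (potential-via (a≢b ∘ sym) t≢b t≢a) ⟩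
    ½ * L a b t + ½ * L b a t
      ≡⟨ cong (λ y → ½ * L a b t + ½ * (y + X b t - X a t)) (X-comm b a) ⟩
    ½ * L a b t + ½ * (X a b + X b t - X a t)
      ≡⟨ solve 3 (λ p q r → con ½ :* (p :+ q :- r) :+ con ½ :* (p :+ r :- q) := p)
           refl (X a b) (X a t) (X b t) ⟩
    X a b ∎)
    where
    t : Fin n
    t = proj₁ (avoid 3≤n a b)
    t≢a : t ≢ a
    t≢a = proj₁ (proj₂ (avoid 3≤n a b))
    t≢b : t ≢ b
    t≢b = proj₂ (proj₂ (avoid 3≤n a b))

-- Sign vectors of subsets

signᵇ : Bool → ℚ
signᵇ true  = - 1ℚ
signᵇ false = 1ℚ

sign : Subset n → Fin n → ℚ
sign A v = signᵇ (lookup A v)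

signᵇ² : (b : Bool) → signᵇ b * signᵇ b ≡ 1ℚ
signᵇ² true  = refl
signᵇ² false = refl

negOnePow-bit+bit : (a b : Bool) → negOnePow (bit a ℕ.+ bit b) ≡ signᵇ a * signᵇ b
negOnePow-bit+bit true  true  = refl
negOnePow-bit+bit true  false = refl
negOnePow-bit+bit false true  = refl
negOnePow-bit+bit false false = refl

signᵇ-gap-cancel : {a b : Bool} → a ≢ b → (y : ℚ) → (signᵇ b - signᵇ a) * y ≡ 0ℚ → y ≡ 0ℚ
signᵇ-gap-cancel {true}  {true}  a≢b = ⊥-elim (a≢b refl)
signᵇ-gap-cancel {false} {false} a≢b = ⊥-elim (a≢b refl)
signᵇ-gap-cancel {true}  {false} _ y 2y≡0 = begin
  y                           ≡⟨ solve 1 (λ y → y := con ½ :* ((con 1ℚ :- con (- 1ℚ)) :* y)) refl y ⟩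
  ½ * ((1ℚ - - 1ℚ) * y)       ≡⟨ cong (½ *_) 2y≡0 ⟩
  ½ * 0ℚ                      ≡⟨ ℚₚ.*-zeroʳ ½ ⟩
  0ℚ                          ∎
signᵇ-gap-cancel {false} {true}  _ y -2y≡0 = begin
  y                           ≡⟨ solve 1 (λ y → y := con (- ½) :* ((con (- 1ℚ) :- con 1ℚ) :* y)) refl y ⟩
  - ½ * ((- 1ℚ - 1ℚ) * y)     ≡⟨ cong (- ½ *_) -2y≡0 ⟩
  - ½ * 0ℚ                    ≡⟨ ℚₚ.*-zeroʳ (- ½) ⟩
  0ℚ                          ∎

∑-sign : (A : Subset n) → ∑[ v < n ] sign A v ≡ ∣ ∁ A ∣ ×ℚ 1ℚ - ∣ A ∣ ×ℚ 1ℚ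
∑-sign []          = refl
∑-sign (true ∷ A)  = trans (cong (- 1ℚ +_) (∑-sign A))
  (solve 2 (λ p q → :- con 1ℚ :+ (p :- q) := p :- (con 1ℚ :+ q)) refl (∣ ∁ A ∣ ×ℚ 1ℚ) (∣ A ∣ ×ℚ 1ℚ))
∑-sign (false ∷ A) = trans (cong (1ℚ +_) (∑-sign A))
  (solve 2 (λ p q → con 1ℚ :+ (p :- q) := (con 1ℚ :+ p) :- q) refl (∣ ∁ A ∣ ×ℚ 1ℚ) (∣ A ∣ ×ℚ 1ℚ))

∣∁A∣≡h : {h : ℕ} → n ≡ h ℕ.+ h → {A : Subset n} → ∣ A ∣ ≡ h → ∣ ∁ A ∣ ≡ h
∣∁A∣≡h {h = h} n≡h+h {A} ∣A∣≡h =
  trans (∣∁p∣≡n∸∣p∣ A) (trans (cong₂ ℕ._∸_ n≡h+h ∣A∣≡h) (ℕₚ.m+n∸n≡m h h))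

∑-sign-balanced : {h : ℕ} → n ≡ h ℕ.+ h → {A : Subset n} → ∣ A ∣ ≡ h → ∑[ v < n ] sign A v ≡ 0ℚ
∑-sign-balanced {h = h} n≡h+h {A} ∣A∣≡h = trans (∑-sign A)
  (trans (cong₂ (λ p q → p ×ℚ 1ℚ - q ×ℚ 1ℚ) (∣∁A∣≡h n≡h+h {A} ∣A∣≡h) ∣A∣≡h)
         (ℚₚ.+-inverseʳ (h ×ℚ 1ℚ)))

transposeSubset : Fin n → Fin n → Subset n → Subset n
transposeSubset i j A = Vec.tabulate (lookup A ∘ PC.transpose i j)

lookup-transposeSubset : (i j : Fin n) (A : Subset n) (w : Fin n) →
  lookup (transposeSubset i j A) w ≡ lookup A (PC.transpose i j w)
lookup-transposeSubset i j A = Vecₚ.lookup∘tabulate (lookup A ∘ PC.transpose i j)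

∣A∣≡∑bit : (A : Subset n) → ∣ A ∣ ≡ ℕSum.sum (bit ∘ lookup A)
∣A∣≡∑bit []          = refl
∣A∣≡∑bit (true ∷ A)  = cong suc (∣A∣≡∑bit A)
∣A∣≡∑bit (false ∷ A) = ∣A∣≡∑bit A

∣transposeSubset∣ : (i j : Fin n) (A : Subset n) → ∣ transposeSubset i j A ∣ ≡ ∣ A ∣
∣transposeSubset∣ i j A = begin
  ∣ transposeSubset i j A ∣                       ≡⟨ ∣A∣≡∑bit (transposeSubset i j A) ⟩
  ℕSum.sum (bit ∘ lookup (transposeSubset i j A)) ≡⟨ ℕSum.sum-cong-≗ (cong bit ∘ lookup-transposeSubset i j A) ⟩
  ℕSum.sum (bit ∘ lookup A ∘ PC.transpose i j)   ≡⟨ ℕSum.∑-permute (bit ∘ lookup A) (Perm.transpose i j) ⟨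
  ℕSum.sum (bit ∘ lookup A)                      ≡⟨ ∣A∣≡∑bit A ⟨
  ∣ A ∣                                           ∎

transposeSubset-balanced : {h : ℕ} (i j : Fin n) (A : Subset n) → ∣ A ∣ ≡ h → ∣ transposeSubset i j A ∣ ≡ h
transposeSubset-balanced i j A ∣A∣≡h = trans (∣transposeSubset∣ i j A) ∣A∣≡h

sign-transposeSubset : (i j : Fin n) (A : Subset n) (w : Fin n) →
  sign (transposeSubset i j A) w ≡ sign A (PC.transpose i j w)
sign-transposeSubset i j A w = cong signᵇ (lookup-transposeSubset i j A w)

∃-inside : (A : Subset n) → 1 ℕ.≤ ∣ A ∣ → ∃[ u ] lookup A u ≡ true
∃-inside (true  ∷ A) _       = zero , refl
∃-inside (false ∷ A) 1≤∣A∣ = Product.map suc id (∃-inside A 1≤∣A∣)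

∃-inside-≢ : (A : Subset n) (p : Fin n) → 2 ℕ.≤ ∣ A ∣ → ∃[ u ] lookup A u ≡ true × u ≢ p
∃-inside-≢ (true  ∷ A) zero    (ℕ.s≤s 1≤∣A∣) = Product.map suc (λ Au → Au , λ ()) (∃-inside A 1≤∣A∣)
∃-inside-≢ (true  ∷ A) (suc p) _               = zero , refl , λ ()
∃-inside-≢ (false ∷ A) zero    2≤∣A∣ =
  Product.map suc (λ Au → Au , λ ()) (∃-inside A (ℕₚ.≤-trans (ℕₚ.n≤1+n 1) 2≤∣A∣))
∃-inside-≢ (false ∷ A) (suc p) 2≤∣A∣ =
  Product.map suc (Product.map₂ (_∘ Finₚ.suc-injective)) (∃-inside-≢ A p 2≤∣A∣)

module Separation {n h : ℕ} (n≡h+h : n ≡ h ℕ.+ h) (2≤h : 2 ℕ.≤ h) where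

  ∃-with-value : (A : Subset n) → ∣ A ∣ ≡ h → (b : Bool) (p : Fin n) → ∃[ u ] lookup A u ≡ b × u ≢ p
  ∃-with-value A ∣A∣≡h true p = ∃-inside-≢ A p (subst (2 ℕ.≤_) (sym ∣A∣≡h) 2≤h)
  ∃-with-value A ∣A∣≡h false p =
    Product.map₂ (Product.map₁ λ ∁Au≡true →
                   Boolₚ.not-injective (trans (sym (Vecₚ.lookup-map _ not A)) ∁Au≡true))
      (∃-inside-≢ (∁ A) p (subst (2 ℕ.≤_) (sym (∣∁A∣≡h n≡h+h {A} ∣A∣≡h)) 2≤h))

  -- If k and l lie on the same side of A, exchange l with a point u ≠ p of the other side.
  separate : (A : Subset n) → ∣ A ∣ ≡ h → {k l : Fin n} → k ≢ l → (p : Fin n) → p ≢ l →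
    ∃[ B ] ∣ B ∣ ≡ h × lookup B k ≢ lookup B l × lookup B p ≡ lookup A p
      × (∀ w → w ≢ l → lookup A w ≡ lookup A l → lookup B w ≡ lookup A w)
  separate A ∣A∣≡h {k} {l} k≢l p p≢l with lookup A k Boolₚ.≟ lookup A l
  ... | no Ak≢Al  = A , ∣A∣≡h , Ak≢Al , refl , λ _ _ _ → refl
  ... | yes Ak≡Al =
    transposeSubset l u A , transposeSubset-balanced l u A ∣A∣≡h ,
    (λ Bk≡Bl → Au≢Al (trans (sym Bl≡Au) (trans (sym Bk≡Bl) (trans (fixed k≢l k≢u) Ak≡Al)))) ,
    fixed p≢l (proj₂ (proj₂ other) ∘ sym) ,
    (λ w w≢l Aw≡Al → fixed w≢l (λ w≡u → Au≢Al (trans (cong (lookup A) (sym w≡u)) Aw≡Al)))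
    where
    other : ∃[ u ] lookup A u ≡ not (lookup A l) × u ≢ p
    other = ∃-with-value A ∣A∣≡h (not (lookup A l)) p
    u : Fin n
    u = proj₁ other
    Au≢Al : lookup A u ≢ lookup A l
    Au≢Al Au≡Al = Boolₚ.not-¬ refl (trans (sym Au≡Al) (proj₁ (proj₂ other)))
    k≢u : k ≢ u
    k≢u k≡u = Au≢Al (trans (cong (lookup A) (sym k≡u)) Ak≡Al)
    fixed : {w : Fin n} → w ≢ l → w ≢ u → lookup (transposeSubset l u A) w ≡ lookup A w
    fixed w≢l w≢u = trans (lookup-transposeSubset l u A _) (cong (lookup A) (transpose-other w≢l w≢u))
    Bl≡Au : lookup (transposeSubset l u A) l ≡ lookup A u
    Bl≡Au = trans (lookup-transposeSubset l u A l) (cong (lookup A) (transpose-matchˡ l u))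

  -- Separate i from j, then k from l while protecting whichever of i, j is not on the side of l.
  separating : (A : Subset n) → ∣ A ∣ ≡ h → {i j k l : Fin n} → i ≢ j → i ≢ l → j ≢ l → k ≢ l →
    ∃[ B ] ∣ B ∣ ≡ h × lookup B i ≢ lookup B j × lookup B k ≢ lookup B l
  separating A ∣A∣≡h {i} {j} {k} {l} i≢j i≢l j≢l k≢l with separate A ∣A∣≡h i≢j i i≢j
  ... | B , ∣B∣≡h , Bi≢Bj , _ , _ with lookup B i Boolₚ.≟ lookup B l
  ...   | yes Bi≡Bl =
    let C , ∣C∣≡h , Ck≢Cl , Cj≡Bj , keep = separate B ∣B∣≡h k≢l j j≢l
    in C , ∣C∣≡h , (λ Ci≡Cj → Bi≢Bj (trans (sym (keep i i≢l Bi≡Bl)) (trans Ci≡Cj Cj≡Bj))) , Ck≢Cl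
  ...   | no Bi≢Bl =
    let C , ∣C∣≡h , Ck≢Cl , Ci≡Bi , keep = separate B ∣B∣≡h k≢l i i≢l
        Bj≡Bl : lookup B j ≡ lookup B l
        Bj≡Bl = trans (Boolₚ.¬-not (Bi≢Bj ∘ sym)) (sym (Boolₚ.¬-not (Bi≢Bl ∘ sym)))
    in C , ∣C∣≡h , (λ Ci≡Cj → Bi≢Bj (trans (sym Ci≡Bi) (trans Ci≡Cj (keep j j≢l Bj≡Bl)))) , Ck≢Cl

rowÑ≡pairForm : (A : Subset n) (x : Pair n → ℚ) → sumPairs n (λ p → Nentry A p * x p) ≡ pairForm (sign A) x
rowÑ≡pairForm A x = sumPairs-cong λ p → cong (_* x p) (negOnePow-bit+bit (lookup A (fst p)) (lookup A (snd p)))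

Bentry≡δ+δ : (v : Fin n) (p : Pair n) → Bentry v p ≡ δ (fst p) v + δ (snd p) v
Bentry≡δ+δ v (pair a b a<b) with v Finₚ.≟ a | v Finₚ.≟ b
... | yes refl | yes refl = ⊥-elim (Finₚ.<-irrefl refl a<b)
... | yes refl | no v≢b   = sym (cong₂ _+_ (δ-refl v) (δ-≢ (v≢b ∘ sym)))
... | no v≢a   | yes refl = sym (cong₂ _+_ (δ-≢ (v≢a ∘ sym)) (δ-refl v))
... | no v≢a   | no v≢b   = sym (cong₂ _+_ (δ-≢ (v≢a ∘ sym)) (δ-≢ (v≢b ∘ sym)))

combination-B̃ : (μ : Fin n → ℚ) (p : Pair n) → sumFin n (λ v → μ v * Bentry v p) ≡ μ (fst p) + μ (snd p)
combination-B̃ {n} μ p = begin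
  sumFin n (λ v → μ v * Bentry v p)
    ≡⟨ sumFin≡∑ (λ v → μ v * Bentry v p) ⟩
  ∑[ v < n ] (μ v * Bentry v p)
    ≡⟨ sum-cong-≗ (λ v → trans (cong (μ v *_) (Bentry≡δ+δ v p))
         (solve 3 (λ m d e → m :* (d :+ e) := d :* m :+ e :* m) refl (μ v) (δ (fst p) v) (δ (snd p) v))) ⟩
  ∑[ v < n ] (δ (fst p) v * μ v + δ (snd p) v * μ v)
    ≡⟨ ∑-distrib-+ (λ v → δ (fst p) v * μ v) (λ v → δ (snd p) v * μ v) ⟩
  ∑[ v < n ] (δ (fst p) v * μ v) + ∑[ v < n ] (δ (snd p) v * μ v)
    ≡⟨ cong₂ _+_ (∑-δ (fst p) μ) (∑-δ (snd p) μ) ⟩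
  μ (fst p) + μ (snd p) ∎

combination-B̃-last : (μ : Fin n → ℚ) → sumFin n (λ v → μ v * 1ℚ) ≡ ∑[ v < n ] μ v
combination-B̃-last μ = trans (sumFin≡∑ (λ v → μ v * 1ℚ)) (sum-cong-≗ (ℚₚ.*-identityʳ ∘ μ))

rowSpace⇒kernel : {h : ℕ} → n ≡ h ℕ.+ h → (x : Pair n → ℚ) (c : ℚ) →
  InRowSpaceB̃ n x c → InKernelÑ n (λ A → ∣ A ∣ ≡ h) x c
rowSpace⇒kernel {n} n≡h+h x c (μ , x≡Bᵀμ , c≡1ᵀμ) A ∣A∣≡h = begin
  sumPairs n (λ p → Nentry A p * x p) + c
    ≡⟨ cong₂ _+_ (rowÑ≡pairForm A x) (trans c≡1ᵀμ (combination-B̃-last μ)) ⟩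
  pairForm (sign A) x + ∑[ v < n ] μ v
    ≡⟨ cong (_+ ∑[ v < n ] μ v)
         (pairForm-cong {s = sign A} (λ _ → refl) (λ p → trans (x≡Bᵀμ p) (combination-B̃ μ p))) ⟩
  pairForm (sign A) (λ p → μ (fst p) + μ (snd p)) + ∑[ v < n ] μ v
    ≡⟨ pairForm-edgeSums (sign A) μ (∑-sign-balanced n≡h+h {A} ∣A∣≡h) (signᵇ² ∘ lookup A) ⟩
  0ℚ ∎

module KernelToRowSpace {n h : ℕ} (n≡h+h : n ≡ h ℕ.+ h) (2≤h : 2 ℕ.≤ h)
  (A₀ : Subset n) (∣A₀∣≡h : ∣ A₀ ∣ ≡ h)
  {x : Pair n → ℚ} {c : ℚ} (kernel : InKernelÑ n (λ A → ∣ A ∣ ≡ h) x c) where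

  open Separation n≡h+h 2≤h

  pairForm+c≡0 : (A : Subset n) → ∣ A ∣ ≡ h → pairForm (sign A) x + c ≡ 0ℚ
  pairForm+c≡0 A ∣A∣≡h = trans (cong (_+ c) (sym (rowÑ≡pairForm A x))) (kernel A ∣A∣≡h)

  pairForm-balanced : (A : Subset n) → ∣ A ∣ ≡ h → pairForm (sign A) x ≡ pairForm (sign A₀) x
  pairForm-balanced A ∣A∣≡h =
    ∙-cancelʳ c _ _ (trans (pairForm+c≡0 A ∣A∣≡h) (sym (pairForm+c≡0 A₀ ∣A₀∣≡h)))

  secondDifference≡0 : (B : Subset n) → ∣ B ∣ ≡ h → {i j k l : Fin n} →
    i ≢ j → i ≢ k → i ≢ l → j ≢ k → j ≢ l → k ≢ l →
    (sign B j - sign B i) * (sign B l - sign B k)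
      * (symExt x i k - symExt x i l - (symExt x j k - symExt x j l)) ≡ 0ℚ
  secondDifference≡0 B ∣B∣≡h {i} {j} {k} {l} i≢j i≢k i≢l j≢k j≢l k≢l =
    identityʳ-unique (q + q) _ (sym (begin
      q + q
        ≡⟨ cong₂ _+_ (sym (pairForm-balanced Bᵢⱼₖₗ (transposeSubset-balanced k l Bᵢⱼ Bᵢⱼ-balanced)))
                     (sym (pairForm-balanced B ∣B∣≡h)) ⟩
      pairForm (sign Bᵢⱼₖₗ) x + pairForm s x
        ≡⟨ cong (_+ pairForm s x) (pairForm-cong (λ w → trans (sign-transposeSubset k l Bᵢⱼ w)
                                                     (sign-transposeSubset i j B _)) (λ _ → refl)) ⟩
      pairForm (s ∘ PC.transpose i j ∘ PC.transpose k l) x + pairForm s x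
        ≡⟨ pairForm-doubleTransposition x s i≢j i≢k i≢l j≢k j≢l k≢l ⟩
      pairForm (s ∘ PC.transpose i j) x + pairForm (s ∘ PC.transpose k l) x + D
        ≡⟨ cong (_+ D) (cong₂ _+_ (transposed-form i j) (transposed-form k l)) ⟩
      q + q + D ∎))
    where
    s : Fin n → ℚ
    s = sign B
    q D : ℚ
    q = pairForm (sign A₀) x
    D = (s j - s i) * (s l - s k) * (symExt x i k - symExt x i l - (symExt x j k - symExt x j l))
    Bᵢⱼ Bᵢⱼₖₗ : Subset n
    Bᵢⱼ = transposeSubset i j B
    Bᵢⱼₖₗ = transposeSubset k l Bᵢⱼ
    Bᵢⱼ-balanced : ∣ Bᵢⱼ ∣ ≡ h
    Bᵢⱼ-balanced = transposeSubset-balanced i j B ∣B∣≡h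
    transposed-form : (a b : Fin n) → pairForm (s ∘ PC.transpose a b) x ≡ q
    transposed-form a b = trans (pairForm-cong (sym ∘ sign-transposeSubset a b B) (λ _ → refl))
      (pairForm-balanced (transposeSubset a b B) (transposeSubset-balanced a b B ∣B∣≡h))

  fourCycle : ∀ {i j k l} → i ≢ j → i ≢ k → i ≢ l → j ≢ k → j ≢ l → k ≢ l →
    symExt x i k - symExt x i l - (symExt x j k - symExt x j l) ≡ 0ℚ
  fourCycle {i} {j} {k} {l} i≢j i≢k i≢l j≢k j≢l k≢l
    with separating A₀ ∣A₀∣≡h i≢j i≢l j≢l k≢l
  ... | B , ∣B∣≡h , Bi≢Bj , Bk≢Bl = signᵇ-gap-cancel Bk≢Bl C (signᵇ-gap-cancel Bi≢Bj _
    (trans (sym (ℚₚ.*-assoc (sign B j - sign B i) (sign B l - sign B k) C))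
           (secondDifference≡0 B ∣B∣≡h i≢j i≢k i≢l j≢k j≢l k≢l)))
    where
    C : ℚ
    C = symExt x i k - symExt x i l - (symExt x j k - symExt x j l)

  3≤n : 3 ℕ.≤ n
  3≤n = subst (3 ℕ.≤_) (sym n≡h+h) (ℕₚ.≤-trans (ℕₚ.n≤1+n 3) (ℕₚ.+-mono-≤ 2≤h 2≤h))

  open Potential 3≤n (symExt x) (symExt-comm x) fourCycle

  x≡edgeSums : ∀ p → x p ≡ potential (fst p) + potential (snd p)
  x≡edgeSums p = trans (symExt-pair x p) (X≡potential+potential (Finₚ.<⇒≢ (fst<snd p)))

  c≡∑potential : c ≡ ∑[ v < n ] potential v
  c≡∑potential = ∙-cancelˡ (pairForm (sign A₀) x) c _ (trans (pairForm+c≡0 A₀ ∣A₀∣≡h) (sym (trans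
    (cong (_+ ∑[ v < n ] potential v) (pairForm-cong {s = sign A₀} (λ _ → refl) x≡edgeSums))
    (pairForm-edgeSums (sign A₀) potential (∑-sign-balanced n≡h+h {A₀} ∣A₀∣≡h) (signᵇ² ∘ lookup A₀)))))

  rowSpace : InRowSpaceB̃ n x c
  rowSpace = potential
           , (λ p → trans (x≡edgeSums p) (sym (combination-B̃ potential p)))
           , trans c≡∑potential (sym (combination-B̃-last potential))

alternating : (m : ℕ) → Subset (m ℕ.* 4)
alternating zero    = []
alternating (suc m) = true ∷ true ∷ false ∷ false ∷ alternating m

∣alternating∣ : (m : ℕ) → ∣ alternating m ∣ ≡ m ℕ.* 2
∣alternating∣ zero    = refl
∣alternating∣ (suc m) = cong (2 ℕ.+_) (∣alternating∣ m)

*4/2 : (m : ℕ) → m ℕ.* 4 / 2 ≡ m ℕ.* 2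
*4/2 m = trans (cong (_/ 2) (sym (ℕₚ.*-assoc m 2 2))) (m*n/n≡m (m ℕ.* 2) 2)

mainTheorem4 : (n : ℕ) → 0 < n → 4 ∣ n →
    (x : Pair n → ℚ) → (c : ℚ) →
    (InKernelÑ n (λ A → ∣ A ∣ ≡ n / 2) x c → InRowSpaceB̃ n x c)
    × (InRowSpaceB̃ n x c → InKernelÑ n (λ A → ∣ A ∣ ≡ n / 2) x c)
mainTheorem4 .(zero ℕ.* 4) () (divides zero refl) x c
mainTheorem4 .(suc r ℕ.* 4) _ (divides (suc r) refl) x c =
  (λ kernel → KernelToRowSpace.rowSpace n≡h+h 2≤h (alternating (suc r)) ∣alternating∣≡h kernel) ,
  rowSpace⇒kernel n≡h+h x c
  where
  half : suc r ℕ.* 4 / 2 ≡ suc r ℕ.* 2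
  half = *4/2 (suc r)
  n≡h+h : suc r ℕ.* 4 ≡ suc r ℕ.* 4 / 2 ℕ.+ suc r ℕ.* 4 / 2
  n≡h+h = trans (ℕₚ.*-distribˡ-+ (suc r) 2 2) (sym (cong₂ ℕ._+_ half half))
  2≤h : 2 ℕ.≤ suc r ℕ.* 4 / 2
  2≤h = subst (2 ℕ.≤_) (sym half) (ℕₚ.m≤m+n 2 (r ℕ.* 2))
  ∣alternating∣≡h : ∣ alternating (suc r) ∣ ≡ suc r ℕ.* 4 / 2
  ∣alternating∣≡h = trans (∣alternating∣ (suc r)) (sym half)
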